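{- FFEL is a sublogic of FSCL: for all $P, Q \in \mathrm{FT}$, if $\mathrm{fe}(P) = \mathrm{fe}(Q)$ (i.e. $\mathrm{FFEL} \vDash P = Q$), then $\mathrm{CP}_s \vdash h(P) = h(Q)$ (i.e. $\mathrm{FSCL} \vDash h(P) = h(Q)$).
   Context: Let $A$ be a countable set of atoms. $\mathrm{FT}$ is generated by $P ::= a \ (a \in A) \mid \mathsf{T} \mid \mathsf{F} \mid \neg P \mid (P \wedge^{\bullet} P) \mid (P \vee^{\bullet} P)$ (full left-sequential connectives), and $\mathrm{ST}$ by the same grammar with short-circuit connectives $\wedge^{\circ}, \vee^{\circ}$. Let $\mathcal{T}$ be the set of finite binary trees: $\mathsf{T}, \mathsf{F} \in \mathcal{T}$ and $(X \trianglelefteq a \trianglerighteq Y) \in \mathcal{T}$ for $X, Y \in \mathcal{T}$, $a \in A$. Leaf replacement: $\mathsf{T}[\mathsf{T}\mapsto Y, \mathsf{F}\mapsto Z] = Y$, $\mathsf{F}[\mathsf{T}\mapsto Y, \mathsf{F}\mapsto Z] = Z$, $(X' \trianglelefteq a \trianglerighteq X'')[\mathsf{T}\mapsto Y, \mathsf{F}\mapsto Z] = X'[\ldots] \trianglelefteq a \trianglerighteq X''[\ldots]$; unmentioned leaves unchanged. $\mathrm{fe}: \mathrm{FT} \to \mathcal{T}$: $\mathrm{fe}(\mathsf{T}) = \mathsf{T}$, $\mathrm{fe}(\mathsf{F}) = \mathsf{F}$, $\mathrm{fe}(a) = \mathsf{T} \trianglelefteq a \trianglerighteq \mathsf{F}$,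 $\mathrm{fe}(\neg P) = \mathrm{fe}(P)[\mathsf{T}\mapsto\mathsf{F}, \mathsf{F}\mapsto\mathsf{T}]$, $\mathrm{fe}(P \wedge^{\bullet} Q) = \mathrm{fe}(P)[\mathsf{T}\mapsto \mathrm{fe}(Q), \mathsf{F}\mapsto \mathrm{fe}(Q)[\mathsf{T}\mapsto\mathsf{F}]]$, $\mathrm{fe}(P \vee^{\bullet} Q) = \mathrm{fe}(P)[\mathsf{T}\mapsto \mathrm{fe}(Q)[\mathsf{F}\mapsto\mathsf{T}], \mathsf{F}\mapsto \mathrm{fe}(Q)]$. The translation $h: \mathrm{FT} \to \mathrm{ST}$ is: $h(\mathsf{T}) = \mathsf{T}$, $h(\mathsf{F}) = \mathsf{F}$, $h(a) = a$, $h(\neg P) = \neg h(P)$, $h(P \wedge^{\bullet} Q) = (h(P) \vee^{\circ} (h(Q) \wedge^{\circ} \mathsf{F})) \wedge^{\circ} h(Q)$, $h(P \vee^{\bullet} Q) = (h(P) \wedge^{\circ} (h(Q) \vee^{\circ} \mathsf{T})) \vee^{\circ} h(Q)$. Terms $\mathrm{CT}_s$ are generated by $P ::= a \mid \mathsf{T} \mid \mathsf{F} \mid P \triangleleft P \triangleright P \mid \neg P \mid P \wedge^{\circ} P \mid P \vee^{\circ} P$, with $y \triangleleft x \triangleright z$ the conditional "if $x$ then $y$ else $z$". $\mathrm{CP}_s$ consists of $x \triangleleft \mathsf{T} \triangleright y = x$; $x \triangleleft \mathsf{F} \triangleright y = y$; $\mathsf{T} \triangleleft x \triangleright \mathsf{F}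 = x$; $x \triangleleft (y \triangleleft z \triangleright u) \triangleright v = (x \triangleleft y \triangleright v) \triangleleft z \triangleright (x \triangleleft u \triangleright v)$; $\neg x = \mathsf{F} \triangleleft x \triangleright \mathsf{T}$; $x \wedge^{\circ} y = y \triangleleft x \triangleright \mathsf{F}$; $x \vee^{\circ} y = \mathsf{T} \triangleleft x \triangleright y$; $\mathrm{CP}_s \vdash s = t$ denotes equational derivability, and $\mathrm{FSCL} \vDash P = Q$ iff $\mathrm{CP}_s \vdash P = Q$. -}

module Defs where

open import Data.Nat using (ℕ)

-- The countable set of atoms A is taken to be ℕ.
Atom : Set
Atom = ℕ

-- FT: terms with full left-sequential connectives
data FT : Set where
  atom : Atom → FT
  𝕋 𝔽  : FT
  ¬ᶠ_  : FT → FT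
  _∧●_ : FT → FT → FT
  _∨●_ : FT → FT → FT

data Tree : Set where
  T F : Tree
  node : Tree → Atom → Tree → Tree   -- node X a Y  =  X ⊴ a ⊵ Y

_[T↦_,F↦_] : Tree → Tree → Tree → Tree
T [T↦ Y ,F↦ Z ] = Y
F [T↦ Y ,F↦ Z ] = Z
node X' a X'' [T↦ Y ,F↦ Z ] = node (X' [T↦ Y ,F↦ Z ]) a (X'' [T↦ Y ,F↦ Z ])

fe : FT → Tree
fe (atom a) = node T a F
fe 𝕋 = T
fe 𝔽 = F
fe (¬ᶠ P) = fe P [T↦ F ,F↦ T ]
fe (P ∧● Q) = fe P [T↦ fe Q ,F↦ (fe Q [T↦ F ,F↦ F ]) ]
fe (P ∨● Q) = fe P [T↦ (fe Q [T↦ T ,F↦ T ]) ,F↦ fe Q ]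

-- CT_s: conditional terms with short-circuit connectives
-- (ST is the sublanguage without the conditional)
data CT : Set where
  atom : Atom → CT
  𝕋 𝔽  : CT
  _◁_▷_ : CT → CT → CT → CT        -- y ◁ x ▷ z : if x then y else z
  ¬ˢ_  : CT → CT
  _∧∘_ : CT → CT → CT
  _∨∘_ : CT → CT → CT

h : FT → CT
h (atom a) = atom a
h 𝕋 = 𝕋
h 𝔽 = 𝔽
h (¬ᶠ P) = ¬ˢ h P
h (P ∧● Q) = (h P ∨∘ (h Q ∧∘ 𝔽)) ∧∘ h Q
h (P ∨● Q) = (h P ∧∘ (h Q ∨∘ 𝕋)) ∨∘ h Q

data CP⊢_≈_ : CT → CT → Set where
  refl  : ∀ {s} → CP⊢ s ≈ s
  sym   : ∀ {s t} → CP⊢ s ≈ t → CP⊢ t ≈ s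
  trans : ∀ {s t u} → CP⊢ s ≈ t → CP⊢ t ≈ u → CP⊢ s ≈ u
  cong-cond : ∀ {s s' t t' u u'} → CP⊢ s ≈ s' → CP⊢ t ≈ t' → CP⊢ u ≈ u' →
              CP⊢ (s ◁ t ▷ u) ≈ (s' ◁ t' ▷ u')
  cong-¬ : ∀ {s s'} → CP⊢ s ≈ s' → CP⊢ (¬ˢ s) ≈ (¬ˢ s')
  cong-∧ : ∀ {s s' t t'} → CP⊢ s ≈ s' → CP⊢ t ≈ t' → CP⊢ (s ∧∘ t) ≈ (s' ∧∘ t')
  cong-∨ : ∀ {s s' t t'} → CP⊢ s ≈ s' → CP⊢ t ≈ t' → CP⊢ (s ∨∘ t) ≈ (s' ∨∘ t')
  CP1 : ∀ x y → CP⊢ (x ◁ 𝕋 ▷ y) ≈ x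
  CP2 : ∀ x y → CP⊢ (x ◁ 𝔽 ▷ y) ≈ y
  CP3 : ∀ x → CP⊢ (𝕋 ◁ x ▷ 𝔽) ≈ x
  CP4 : ∀ x y z u v →
        CP⊢ (x ◁ (y ◁ z ▷ u) ▷ v) ≈ ((x ◁ y ▷ v) ◁ z ▷ (x ◁ u ▷ v))
  CP-¬ : ∀ x → CP⊢ (¬ˢ x) ≈ (𝔽 ◁ x ▷ 𝕋)
  CP-∧ : ∀ x y → CP⊢ (x ∧∘ y) ≈ (y ◁ x ▷ 𝔽)
  CP-∨ : ∀ x y → CP⊢ (x ∨∘ y) ≈ (𝕋 ◁ x ▷ y)

-- Idea: read a tree as a conditional term, X ⊴ a ⊵ Y ↦ ⟦X⟧ ◁ a ▷ ⟦Y⟧.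
-- Under this reading leaf replacement becomes conditional composition:
--   y ◁ ⟦X⟧ ▷ z  =  ⟦X[T ↦ Y, F ↦ Z]⟧   whenever y = ⟦Y⟧ and z = ⟦Z⟧,
-- which follows from CP1, CP2 and the distribution axiom CP4 by induction
-- on X.  Using it, and the equations of CP_s that eliminate ¬, ∧∘ and ∨∘,
-- an induction on P shows  CP_s ⊢ h(P) = ⟦fe(P)⟧  for every P ∈ FT.  The
-- theorem is then immediate: fe(P) = fe(Q) gives ⟦fe(P)⟧ = ⟦fe(Q)⟧.
module Submission where

open import Defs
open import Relation.Binary.PropositionalEquality using (_≡_; cong; cong₂)
import Relation.Binary.PropositionalEquality as ≡
open import Relation.Binary.Bundles using (Setoid)

CP-setoid : Setoid _ _
CP-setoid = record
  { Carrier       = CT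
  ; _≈_           = CP⊢_≈_
  ; isEquivalence = record { refl = refl ; sym = sym ; trans = trans }
  }

open import Relation.Binary.Reasoning.Setoid CP-setoid

≡⇒≈ : ∀ {s t} → s ≡ t → CP⊢ s ≈ t
≡⇒≈ ≡.refl = refl

⟦_⟧ : Tree → CT
⟦ T ⟧ = 𝕋
⟦ F ⟧ = 𝔽
⟦ node X a Y ⟧ = ⟦ X ⟧ ◁ atom a ▷ ⟦ Y ⟧

replace-assoc : ∀ X A B Y Z →
  (X [T↦ A ,F↦ B ]) [T↦ Y ,F↦ Z ] ≡
  X [T↦ A [T↦ Y ,F↦ Z ] ,F↦ B [T↦ Y ,F↦ Z ] ]
replace-assoc T A B Y Z = ≡.refl
replace-assoc F A B Y Z = ≡.refl
replace-assoc (node X a X') A B Y Z =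
  cong₂ (λ L R → node L a R) (replace-assoc X A B Y Z) (replace-assoc X' A B Y Z)

cond-replace : ∀ X {y z Y Z} → CP⊢ y ≈ ⟦ Y ⟧ → CP⊢ z ≈ ⟦ Z ⟧ →
               CP⊢ (y ◁ ⟦ X ⟧ ▷ z) ≈ ⟦ X [T↦ Y ,F↦ Z ] ⟧
cond-replace T {y} {z} y≈Y z≈Z = trans (CP1 y z) y≈Y
cond-replace F {y} {z} y≈Y z≈Z = trans (CP2 y z) z≈Z
cond-replace (node X a X') {y} {z} y≈Y z≈Z =
  trans (CP4 y ⟦ X ⟧ (atom a) ⟦ X' ⟧ z)
        (cong-cond (cond-replace X y≈Y z≈Z) refl (cond-replace X' y≈Y z≈Z))

h≈fe : ∀ P → CP⊢ h P ≈ ⟦ fe P ⟧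
h≈fe (atom a) = sym (CP3 (atom a))
h≈fe 𝕋 = refl
h≈fe 𝔽 = refl
h≈fe (¬ᶠ P) = begin
  ¬ˢ h P             ≈⟨ CP-¬ (h P) ⟩
  𝔽 ◁ h P ▷ 𝕋        ≈⟨ cong-cond refl (h≈fe P) refl ⟩
  𝔽 ◁ ⟦ fe P ⟧ ▷ 𝕋   ≈⟨ cond-replace (fe P) refl refl ⟩
  ⟦ fe (¬ᶠ P) ⟧      ∎
h≈fe (P ∧● Q) = begin
  (h P ∨∘ (h Q ∧∘ 𝔽)) ∧∘ h Q
    ≈⟨ CP-∧ _ _ ⟩
  h Q ◁ h P ∨∘ (h Q ∧∘ 𝔽) ▷ 𝔽
    ≈⟨ cong-cond refl guard refl ⟩
  h Q ◁ (𝕋 ◁ ⟦ fe P ⟧ ▷ ⟦ Q₀ ⟧) ▷ 𝔽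
    ≈⟨ CP4 (h Q) 𝕋 ⟦ fe P ⟧ ⟦ Q₀ ⟧ 𝔽 ⟩
  (h Q ◁ 𝕋 ▷ 𝔽) ◁ ⟦ fe P ⟧ ▷ (h Q ◁ ⟦ Q₀ ⟧ ▷ 𝔽)
    ≈⟨ cong-cond (CP1 _ _) refl falseBranch ⟩
  h Q ◁ ⟦ fe P ⟧ ▷ ⟦ Q₀ ⟧
    ≈⟨ cond-replace (fe P) (h≈fe Q) refl ⟩
  ⟦ fe (P ∧● Q) ⟧ ∎
  where
  Q₀ : Tree
  Q₀ = fe Q [T↦ F ,F↦ F ]

  -- The guard h P ∨∘ (h Q ∧∘ 𝔽) evaluates Q and then forgets its value.
  guard : CP⊢ (h P ∨∘ (h Q ∧∘ 𝔽)) ≈ (𝕋 ◁ ⟦ fe P ⟧ ▷ ⟦ Q₀ ⟧)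
  guard = trans (CP-∨ _ _)
    (cong-cond refl (h≈fe P)
      (trans (CP-∧ _ _) (trans (cong-cond refl (h≈fe Q) refl)
                               (cond-replace (fe Q) refl refl))))

  falseBranch : CP⊢ (h Q ◁ ⟦ Q₀ ⟧ ▷ 𝔽) ≈ ⟦ Q₀ ⟧
  falseBranch = trans (cond-replace Q₀ (h≈fe Q) refl)
                      (≡⇒≈ (cong ⟦_⟧ (replace-assoc (fe Q) F F (fe Q) F)))
h≈fe (P ∨● Q) = begin
  (h P ∧∘ (h Q ∨∘ 𝕋)) ∨∘ h Q
    ≈⟨ CP-∨ _ _ ⟩
  𝕋 ◁ h P ∧∘ (h Q ∨∘ 𝕋) ▷ h Q
    ≈⟨ cong-cond refl guard refl ⟩
  𝕋 ◁ (⟦ Q₁ ⟧ ◁ ⟦ fe P ⟧ ▷ 𝔽) ▷ h Q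
    ≈⟨ CP4 𝕋 ⟦ Q₁ ⟧ ⟦ fe P ⟧ 𝔽 (h Q) ⟩
  (𝕋 ◁ ⟦ Q₁ ⟧ ▷ h Q) ◁ ⟦ fe P ⟧ ▷ (𝕋 ◁ 𝔽 ▷ h Q)
    ≈⟨ cong-cond trueBranch refl (CP2 _ _) ⟩
  ⟦ Q₁ ⟧ ◁ ⟦ fe P ⟧ ▷ h Q
    ≈⟨ cond-replace (fe P) refl (h≈fe Q) ⟩
  ⟦ fe (P ∨● Q) ⟧ ∎
  where
  Q₁ : Tree
  Q₁ = fe Q [T↦ T ,F↦ T ]

  -- The guard h P ∧∘ (h Q ∨∘ 𝕋) evaluates Q and then forgets its value.
  guard : CP⊢ (h P ∧∘ (h Q ∨∘ 𝕋)) ≈ (⟦ Q₁ ⟧ ◁ ⟦ fe P ⟧ ▷ 𝔽)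
  guard = trans (CP-∧ _ _)
    (cong-cond
      (trans (CP-∨ _ _) (trans (cong-cond refl (h≈fe Q) refl)
                               (cond-replace (fe Q) refl refl)))
      (h≈fe P) refl)

  trueBranch : CP⊢ (𝕋 ◁ ⟦ Q₁ ⟧ ▷ h Q) ≈ ⟦ Q₁ ⟧
  trueBranch = trans (cond-replace Q₁ refl (h≈fe Q))
                     (≡⇒≈ (cong ⟦_⟧ (replace-assoc (fe Q) T T T (fe Q))))

mainTheorem7 : (P Q : FT) → fe P ≡ fe Q → CP⊢ h P ≈ h Q
mainTheorem7 P Q feP≡feQ = begin
  h P          ≈⟨ h≈fe P ⟩
  ⟦ fe P ⟧     ≡⟨ cong ⟦_⟧ feP≡feQ ⟩
  ⟦ fe Q ⟧     ≈⟨ h≈fe Q ⟨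
  h Q          ∎
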